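{- Let $G$ and $H$ be block graphs such that $H$ is an induced subgraph of $G$. Assume that $v\in V(H)$ and $\alpha(G,v)=\alpha_{\min}(G)$. Then $\alpha_{\min}(H)\leq \alpha_{\min}(G)$.
   Context: All graphs are finite, simple and undirected. A block graph is a graph in which every block (maximal 2-connected subgraph) is a complete graph. $\alpha(G,v)$ denotes the maximum size of an independent set of $G$ containing $v$, and $\alpha_{\min}(G)=\min_{v\in V(G)}\alpha(G,v)$. -}

module Defs where

open import Data.Nat using (ℕ; _≤_)
open import Data.Fin using (Fin)
open import Data.Bool using (Bool; true; false)
open import Data.Fin.Subset using (Subset; _∈_; _⊆_; _-_; ∣_∣)
open import Data.Product using (Σ; _×_; ∃; ∃-syntax)
open import Data.Sum using (_⊎_)
open import Function.Definitions using (Injective)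
open import Relation.Binary.PropositionalEquality using (_≡_)

record Graph (n : ℕ) : Set where
  field
    adj    : Fin n → Fin n → Bool
    sym    : ∀ i j → adj i j ≡ adj j i
    irrefl : ∀ i → adj i i ≡ false
open Graph public

module _ {n : ℕ} (G : Graph n) where

  data WalkIn (S : Subset n) : Fin n → Fin n → Set where
    here : ∀ {x} → x ∈ S → WalkIn S x x
    step : ∀ {x y z} → x ∈ S → adj G x y ≡ true → WalkIn S y z → WalkIn S x z

  ConnectedOn : Subset n → Set
  ConnectedOn S = (∃[ x ] x ∈ S) × (∀ x y → x ∈ S → y ∈ S → WalkIn S x y)

  NoCutVertexOn : Subset n → Set
  NoCutVertexOn S = ∀ x → x ∈ S → ∀ y z → y ∈ (S - x) → z ∈ (S - x) → WalkIn (S - x) y z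

  Nonseparable : Subset n → Set
  Nonseparable S = ConnectedOn S × NoCutVertexOn S

  IsBlock : Subset n → Set
  IsBlock B = Nonseparable B × (∀ B′ → B ⊆ B′ → Nonseparable B′ → B′ ⊆ B)

  IsClique : Subset n → Set
  IsClique S = ∀ x y → x ∈ S → y ∈ S → x ≡ y ⊎ adj G x y ≡ true

  IsBlockGraph : Set
  IsBlockGraph = ∀ B → IsBlock B → IsClique B

  Independent : Subset n → Set
  Independent S = ∀ x y → x ∈ S → y ∈ S → adj G x y ≡ false

  IsAlphaAt : Fin n → ℕ → Set
  IsAlphaAt v k =
    (∃[ S ] (Independent S × v ∈ S × ∣ S ∣ ≡ k)) ×
    (∀ S → Independent S → v ∈ S → ∣ S ∣ ≤ k)

  IsAlphaMin : ℕ → Set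
  IsAlphaMin k =
    (∃[ v ] IsAlphaAt v k) × (∀ v k′ → IsAlphaAt v k′ → k ≤ k′)

IsInducedEmbedding : ∀ {m n} → Graph m → Graph n → (Fin m → Fin n) → Set
IsInducedEmbedding H G f = Injective _≡_ _≡_ f × (∀ i j → adj H i j ≡ adj G (f i) (f j))

module Submission where

open import Defs hiding (sym)
open import Data.Nat using (ℕ; _≤_; zero; suc; s≤s⁻¹)
open import Data.Nat.Properties using (≤-trans; ≤∧≢⇒<; n≤0⇒n≡0; _≟_)
open import Data.Fin using (Fin; zero; suc)
open import Data.Fin.Properties using (all?; suc-injective) renaming (_≟_ to _≟ᶠ_)
open import Data.Fin.Subset using (Subset; _∈_; _∉_; ∣_∣; ⊥; ⁅_⁆; inside; outside)
open import Data.Fin.Subset.Properties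
  using (_∈?_; anySubset?; ∣p∣≤n; ∣⊥∣≡0; ∉⊥; x∈⁅x⁆; x∈⁅y⁆⇒x≡y)
open import Data.Vec using ([]; _∷_; here; there; _[_]≔_)
open import Data.Vec.Properties using ([]≔-updates; []≔-minimal)
open import Data.Bool using (false)
open import Data.Bool.Properties using () renaming (_≟_ to _≟ᵇ_)
open import Data.Product using (_×_; _,_; ∃-syntax; proj₁; proj₂)
open import Data.Sum using (_⊎_; inj₁; inj₂)
open import Data.Empty using (⊥-elim)
open import Function using (_∘_)
open import Function.Definitions using (Injective)
open import Level using (0ℓ)
open import Relation.Nullary using (yes; no)
open import Relation.Nullary.Decidable using (_→-dec_; _×-dec_)
open import Relation.Unary using (Pred; Decidable)
open import Relation.Binary.PropositionalEquality
  using (_≡_; refl; sym; trans; cong; subst; subst₂)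

insert : ∀ {n} → Fin n → Subset n → Subset n
insert y S = S [ y ]≔ inside

∈-insert⁺ˡ : ∀ {n} (y : Fin n) (S : Subset n) → y ∈ insert y S
∈-insert⁺ˡ y S = []≔-updates S y

∈-insert⁺ʳ : ∀ {n} (y : Fin n) (S : Subset n) {z} → z ∈ S → z ∈ insert y S
∈-insert⁺ʳ y S {z} z∈S with z ≟ᶠ y
... | yes refl = ∈-insert⁺ˡ y S
... | no z≢y   = []≔-minimal S z y z≢y z∈S

∈-insert⁻ : ∀ {n} (y : Fin n) (S : Subset n) {z} → z ∈ insert y S → z ≡ y ⊎ z ∈ S
∈-insert⁻ zero    (_ ∷ S) here      = inj₁ refl
∈-insert⁻ zero    (_ ∷ S) (there p) = inj₂ (there p)
∈-insert⁻ (suc y) (_ ∷ S) here      = inj₂ here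
∈-insert⁻ (suc y) (_ ∷ S) (there p) with ∈-insert⁻ y S p
... | inj₁ refl = inj₁ refl
... | inj₂ z∈S  = inj₂ (there z∈S)

∣insert∣ : ∀ {n} (y : Fin n) (S : Subset n) → y ∉ S → ∣ insert y S ∣ ≡ suc ∣ S ∣
∣insert∣ zero    (inside  ∷ S) y∉S = ⊥-elim (y∉S here)
∣insert∣ zero    (outside ∷ S) y∉S = refl
∣insert∣ (suc y) (inside  ∷ S) y∉S = cong suc (∣insert∣ y S (y∉S ∘ there))
∣insert∣ (suc y) (outside ∷ S) y∉S = ∣insert∣ y S (y∉S ∘ there)

image : ∀ {m n} → (Fin m → Fin n) → Subset m → Subset n
image f []            = ⊥
image f (outside ∷ S) = image (f ∘ suc) S
image f (inside  ∷ S) = insert (f zero) (image (f ∘ suc) S)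

∈-image⁺ : ∀ {m n} (f : Fin m → Fin n) {S x} → x ∈ S → f x ∈ image f S
∈-image⁺ f {inside  ∷ S} here      = ∈-insert⁺ˡ (f zero) _
∈-image⁺ f {outside ∷ S} (there p) = ∈-image⁺ (f ∘ suc) p
∈-image⁺ f {inside  ∷ S} (there p) = ∈-insert⁺ʳ (f zero) _ (∈-image⁺ (f ∘ suc) p)

∈-image⁻ : ∀ {m n} (f : Fin m → Fin n) (S : Subset m) {y} →
           y ∈ image f S → ∃[ x ] (x ∈ S × f x ≡ y)
∈-image⁻ f []            p = ⊥-elim (∉⊥ p)
∈-image⁻ f (outside ∷ S) p with ∈-image⁻ (f ∘ suc) S p
... | x , x∈S , refl = suc x , there x∈S , refl
∈-image⁻ f (inside  ∷ S) p with ∈-insert⁻ (f zero) _ p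
... | inj₁ refl = zero , here , refl
... | inj₂ q with ∈-image⁻ (f ∘ suc) S q
...   | x , x∈S , refl = suc x , there x∈S , refl

∣image∣ : ∀ {m n} (f : Fin m → Fin n) → Injective _≡_ _≡_ f →
          (S : Subset m) → ∣ image f S ∣ ≡ ∣ S ∣
∣image∣ {n = n} f f-inj []     = ∣⊥∣≡0 n
∣image∣ f f-inj (outside ∷ S) = ∣image∣ (f ∘ suc) (suc-injective ∘ f-inj) S
∣image∣ f f-inj (inside  ∷ S) =
  trans (∣insert∣ (f zero) _ f0∉) (cong suc (∣image∣ (f ∘ suc) (suc-injective ∘ f-inj) S))
  where
  f0∉ : f zero ∉ image (f ∘ suc) S
  f0∉ p with ∈-image⁻ (f ∘ suc) S p
  ... | x , _ , fsx≡f0 with f-inj fsx≡f0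
  ...   | ()

IsMaximumSize : ∀ {m} → Pred (Subset m) 0ℓ → Subset m → Set
IsMaximumSize P S = P S × (∀ T → P T → ∣ T ∣ ≤ ∣ S ∣)

-- Any k bounding the sizes is lowered until some S with P S has size k.
maximumSize-below : ∀ {m} (P : Pred (Subset m) 0ℓ) → Decidable P → (k : ℕ) →
                    (∀ T → P T → ∣ T ∣ ≤ k) → ∃[ S ] P S → ∃[ S ] IsMaximumSize P S
maximumSize-below P P? k bound nonempty with anySubset? (λ S → P? S ×-dec (∣ S ∣ ≟ k))
... | yes (S , PS , refl) = S , PS , bound
maximumSize-below P P? zero    bound (S , PS) | no none =
  ⊥-elim (none (S , PS , n≤0⇒n≡0 (bound S PS)))
maximumSize-below P P? (suc k) bound nonempty | no none =
  maximumSize-below P P? k (λ T PT → s≤s⁻¹ (≤∧≢⇒< (bound T PT) (λ ∣T∣≡k → none (T , PT , ∣T∣≡k))))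
    nonempty

maximumSize : ∀ {m} (P : Pred (Subset m) 0ℓ) → Decidable P → ∃[ S ] P S →
              ∃[ S ] IsMaximumSize P S
maximumSize {m} P P? = maximumSize-below P P? m (λ T _ → ∣p∣≤n T)

module _ {n : ℕ} (G : Graph n) where

  independent? : Decidable (Independent G)
  independent? S = all? λ x → all? λ y →
    (x ∈? S) →-dec (y ∈? S) →-dec (adj G x y ≟ᵇ false)

  independent-⁅⁆ : ∀ v → Independent G ⁅ v ⁆
  independent-⁅⁆ v x y x∈ y∈ =
    subst₂ (λ x y → adj G x y ≡ false)
      (sym (x∈⁅y⁆⇒x≡y v x∈)) (sym (x∈⁅y⁆⇒x≡y v y∈)) (irrefl G v)

  alphaAt-exists : ∀ v → ∃[ k ] IsAlphaAt G v k
  alphaAt-exists v with maximumSize (λ S → Independent G S × v ∈ S)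
                          (λ S → independent? S ×-dec (v ∈? S))
                          (⁅ v ⁆ , independent-⁅⁆ v , x∈⁅x⁆ v)
  ... | S , (S-ind , v∈S) , S-max =
    ∣ S ∣ , (S , S-ind , v∈S , refl) , λ T T-ind v∈T → S-max T (T-ind , v∈T)

module _ {m n} {H : Graph m} {G : Graph n} {f : Fin m → Fin n}
         (embedding : IsInducedEmbedding H G f) where

  independent-image : ∀ {S} → Independent H S → Independent G (image f S)
  independent-image {S} S-ind y z y∈ z∈ with ∈-image⁻ f S y∈ | ∈-image⁻ f S z∈
  ... | x , x∈S , refl | x′ , x′∈S , refl =
    trans (sym (proj₂ embedding x x′)) (S-ind x x′ x∈S x′∈S)

  alphaAt-≤-embedding : ∀ {v k a} → IsAlphaAt H v k → IsAlphaAt G (f v) a → k ≤ a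
  alphaAt-≤-embedding ((S , S-ind , v∈S , refl) , _) (_ , G-max) =
    subst (_≤ _) (∣image∣ f (proj₁ embedding) S)
      (G-max (image f S) (independent-image S-ind) (∈-image⁺ f v∈S))

lemma4 : ∀ {m n} (G : Graph n) (H : Graph m) (f : Fin m → Fin n) →
    IsBlockGraph G → IsBlockGraph H → IsInducedEmbedding H G f →
    (v : Fin m) (a : ℕ) → IsAlphaAt G (f v) a → IsAlphaMin G a →
    (b : ℕ) → IsAlphaMin H b → b ≤ a
lemma4 G H f _ _ embedding v a αG[fv]≡a _ b (_ , H-min)
  with alphaAt-exists H v
... | k , αH[v]≡k =
  ≤-trans (H-min v k αH[v]≡k)
          (alphaAt-≤-embedding {H = H} {G = G} {f = f} embedding αH[v]≡k αG[fv]≡a)
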